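{- Let $n\ge 4$ and let $x,y$ be two distinct vertices of the folded hypercube $FQ_n$, and let $r$ be the number of coordinates in which $x$ and $y$ differ. If $r\le\lceil n/2\rceil$, then there is a container between $x$ and $y$ of width $n+1$ and length $r+2$. If $r>\lceil n/2\rceil$, then there is a container between $x$ and $y$ of width $n+1$ and length at most $\lfloor n/2\rfloor+2$.
   Context: $FQ_n$ is the graph with vertex set $\{0,1\}^n$ in which $x,y$ are adjacent iff $x+y\in\{e_1,\dots,e_n,u\}$ (componentwise mod $2$), where $e_i$ is the $i$th unit vector and $u$ is the all-ones vector. A container between two vertices is a set of paths between them that are pairwise internally vertex-disjoint; its width is the number of paths and its length is the maximum length of a path in it. -}

module Defs where

open import Data.Bool using (Bool; true; false; _xor_)
open import Data.Nat using (ℕ; zero; suc; _+_; _≤_)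
open import Data.Fin using (Fin)
import Data.Fin as Fin
open import Data.Vec using (Vec; []; _∷_; zipWith; tabulate; replicate)
open import Data.List using (List; []; _∷_; _++_; length)
open import Data.List.Relation.Unary.Unique.Propositional using (Unique)
open import Data.List.Relation.Unary.Linked using (Linked)
open import Data.List.Membership.Propositional using (_∈_; _∉_)
open import Data.Product using (Σ; ∃; _×_)
open import Data.Sum using (_⊎_)
open import Relation.Binary.PropositionalEquality using (_≡_; _≢_)
open import Relation.Nullary.Decidable using (does)

Vertex : ℕ → Set
Vertex n = Vec Bool n

unitVec : ∀ {n} → Fin n → Vec Bool n
unitVec i = tabulate (λ j → does (i Fin.≟ j))

allOnes : ∀ n → Vec Bool n
allOnes n = replicate n true

FQAdj : ∀ {n} → Vertex n → Vertex n → Set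
FQAdj {n} x y = (Σ (Fin n) λ i → zipWith _xor_ x y ≡ unitVec i)
              ⊎ (zipWith _xor_ x y ≡ allOnes n)

hamming : ∀ {n} → Vertex n → Vertex n → ℕ
hamming [] [] = 0
hamming (a ∷ x) (b ∷ y) with a xor b
... | true  = suc (hamming x y)
... | false = hamming x y

record FQPath (n : ℕ) (x y : Vertex n) : Set where
  field
    internal : List (Vertex n)
    distinct : Unique (x ∷ internal ++ y ∷ [])
    adjacent : Linked FQAdj (x ∷ internal ++ y ∷ [])
open FQPath public

pathLength : ∀ {n x y} → FQPath n x y → ℕ
pathLength p = suc (length (internal p))

record Container (n : ℕ) (x y : Vertex n) (w : ℕ) : Set where
  field
    path : Fin w → FQPath n x y
    pathsDistinct : ∀ i j → i ≢ j → internal (path i) ≢ internal (path j)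
    internallyDisjoint : ∀ i j → i ≢ j → ∀ v →
      v ∈ internal (path i) → v ∉ internal (path j)
open Container public

LengthAtMost : ∀ {n x y w} → Container n x y w → ℕ → Set
LengthAtMost C L = ∀ i → pathLength (path C i) ≤ L

LengthEq : ∀ {n x y w} → Container n x y w → ℕ → Set
LengthEq C L = LengthAtMost C L × ∃ λ i → pathLength (path C i) ≡ L

module Submission where

-- FQ_n is the quotient of the cube Q_{n+1} by complementation: a set P ⊆ {0, …, n} is sent to
-- x + Σ_{i+1 ∈ P} e_i + [0 ∈ P] u, so a set and its complement have the same image and flipping
-- coordinate 0 is a u-edge. Lift x to the empty set and y to a set T with
-- |T| = r (T avoids 0) or |T| = n + 1 - r (T contains 0), whichever the case asks for, and
-- relabel the coordinates so that T = [0, t). In Q_{n+1} take, for each p < t, the rotation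
-- path adding p, p + 1, …, p + t - 1 (mod t), and for each m ≥ t the detour path adding m,
-- then 0, …, t - 1, then removing m. Any two vertices met by these paths either differ at a
-- coordinate and agree at another one, so they remain distinct in FQ_n; this gives n + 1
-- internally disjoint paths of lengths t and t + 2, which needs t + 2 ≤ n.

open import Defs
open import Algebra.Bundles using (CommutativeRing)
open import Data.Bool using (Bool; true; false; _xor_; not; _∧_; _∨_; if_then_else_)
open import Data.Bool.Properties
  using (not-¬; ∧-zeroʳ; ∧-identityʳ; xor-same; xor-assoc; xor-identityʳ; xor-annihilates-not; xor-∧-commutativeRing)
open import Data.Empty using (⊥-elim)
open import Data.Fin using (Fin; zero; suc; toℕ; fromℕ<; punchIn)
import Data.Fin as Fin
open import Data.Fin.Permutation
  using (Permutation; _⟨$⟩ʳ_; _⟨$⟩ˡ_; id; insert; insert-punchIn; inverseˡ; inverseʳ)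
open import Data.Fin.Properties
  using (toℕ-fromℕ<; toℕ<n; toℕ-injective; suc-injective) renaming (0≢1+n to 0≢suc)
open import Data.List using ([]; _∷_; _++_; applyUpTo)
open import Data.List.Properties using (applyUpTo-∷ʳ; length-applyUpTo)
open import Data.List.Membership.Propositional using (_∈_; _∉_)
open import Data.List.Relation.Unary.Linked using (Linked)
open import Data.List.Relation.Unary.Unique.Propositional using (Unique)
import Data.List.Relation.Unary.Any.Properties as Anyₚ
import Data.List.Relation.Unary.Linked.Properties as Linkedₚ
import Data.List.Relation.Unary.Unique.Propositional.Properties as Uniqueₚ
open import Data.Nat
  using (ℕ; zero; suc; _+_; _∸_; _≤_; _<_; _>_; _<ᵇ_; _≤ᵇ_; _≡ᵇ_; _<?_; _≤?_; _≟_; z≤n; s≤s; s≤s⁻¹)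
open import Data.Nat using (⌈_/2⌉; ⌊_/2⌋)
open import Data.Nat.DivMod using (_%_; m%n<n; m<n⇒m%n≡m; %-distribˡ-+; m%n%n≡m%n; [m+n]%n≡m%n; n%n≡0)
open import Data.Nat.Properties hiding (suc-injective)
open import Data.Product using (Σ; ∃; _×_; _,_; proj₁; proj₂)
open import Data.Sum using (_⊎_; inj₁; inj₂)
open import Data.Vec using ([]; _∷_; zipWith; tabulate; lookup)
open import Data.Vec.Properties using (lookup-zipWith; lookup∘tabulate; lookup-replicate)
open import Data.Vec.Relation.Binary.Pointwise.Extensional using (ext; Pointwise-≡⇒≡)
open import Function using (_∘_)
open import Relation.Nullary using (¬_; Dec; yes; no; does)
open import Relation.Nullary.Decidable using (dec-true; dec-false)
open import Relation.Binary.PropositionalEquality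

open import Algebra.Properties.CommutativeSemigroup
  (CommutativeRing.+-commutativeSemigroup xor-∧-commutativeRing) using (interchange)
import Algebra.Properties.CommutativeSemigroup +-commutativeSemigroup as +-CommSemigroup

xor-cancelˡ : ∀ x a b → (x xor a) xor (x xor b) ≡ a xor b
xor-cancelˡ x a b = trans (interchange x a x b) (cong (_xor (a xor b)) (xor-same x))

xor≡false⇒≡ : ∀ {a b} → a xor b ≡ false → a ≡ b
xor≡false⇒≡ {false} {false} _ = refl
xor≡false⇒≡ {true}  {true}  _ = refl

≢⇒xor≡true : ∀ {a b} → a ≢ b → a xor b ≡ true
≢⇒xor≡true {false} {false} a≢b = ⊥-elim (a≢b refl)
≢⇒xor≡true {false} {true}  _   = refl
≢⇒xor≡true {true}  {false} _   = refl
≢⇒xor≡true {true}  {true}  a≢b = ⊥-elim (a≢b refl)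

differ : ∀ {a b v} → a ≡ v → b ≡ not v → a ≢ b
differ refl refl = not-¬ refl

<⇒<ᵇ≡true : ∀ {a b} → a < b → (a <ᵇ b) ≡ true
<⇒<ᵇ≡true {a} {b} = dec-true (a <? b)

≮⇒<ᵇ≡false : ∀ {a b} → ¬ a < b → (a <ᵇ b) ≡ false
≮⇒<ᵇ≡false {a} {b} = dec-false (a <? b)

<ᵇ-suc-≢ : ∀ {o k} → o ≢ k → (o <ᵇ suc k) ≡ (o <ᵇ k)
<ᵇ-suc-≢ {zero}  {zero}  o≢k = ⊥-elim (o≢k refl)
<ᵇ-suc-≢ {zero}  {suc k} _   = refl
<ᵇ-suc-≢ {suc o} {zero}  _   = refl
<ᵇ-suc-≢ {suc o} {suc k} o≢k = <ᵇ-suc-≢ (λ e → o≢k (cong suc e))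

≡ᵇ-refl : ∀ a → (a ≡ᵇ a) ≡ true
≡ᵇ-refl a = dec-true (a ≟ a) refl

≢⇒≡ᵇ≡false : ∀ {a b} → a ≢ b → (a ≡ᵇ b) ≡ false
≢⇒≡ᵇ≡false {a} {b} = dec-false (a ≟ b)

countTrue : ∀ {k} → (Fin k → Bool) → ℕ
countTrue {zero}  T = 0
countTrue {suc k} T with T zero
... | true  = suc (countTrue (λ i → T (suc i)))
... | false = countTrue (λ i → T (suc i))

countTrue≤ : ∀ {k} (T : Fin k → Bool) → countTrue T ≤ k
countTrue≤ {zero}  T = z≤n
countTrue≤ {suc k} T with T zero
... | true  = s≤s (countTrue≤ (λ i → T (suc i)))
... | false = m≤n⇒m≤1+n (countTrue≤ (λ i → T (suc i)))

countTrue+countTrue-not : ∀ {k} (T : Fin k → Bool) → countTrue T + countTrue (λ i → not (T i)) ≡ k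
countTrue+countTrue-not {zero}  T = refl
countTrue+countTrue-not {suc k} T with T zero
... | true  = cong suc (countTrue+countTrue-not (λ i → T (suc i)))
... | false = trans (+-suc _ _) (cong suc (countTrue+countTrue-not (λ i → T (suc i))))

countTrue-not : ∀ {k} (T : Fin k → Bool) → countTrue (λ i → not (T i)) ≡ k ∸ countTrue T
countTrue-not {k} T = trans (sym (m+n∸m≡n (countTrue T) _)) (cong (_∸ countTrue T) (countTrue+countTrue-not T))

punchIn-<ᵇ : ∀ {k} (c : Fin (suc k)) (j : Fin k) → (toℕ (punchIn c j) <ᵇ toℕ c) ≡ (toℕ j <ᵇ toℕ c)
punchIn-<ᵇ zero    j       = refl
punchIn-<ᵇ (suc c) zero    = refl
punchIn-<ᵇ (suc c) (suc j) = punchIn-<ᵇ c j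

sortingPermutation : ∀ {k} (T : Fin k → Bool) →
  Σ (Permutation k k) λ ρ → ∀ g → (toℕ (ρ ⟨$⟩ʳ g) <ᵇ countTrue T) ≡ T g
sortingPermutation {zero} T = id , λ ()
sortingPermutation {suc k} T with sortingPermutation (λ i → T (suc i)) | T zero in T0
... | ρ , sorted | true = insert zero zero ρ , sorted′
  where
  sorted′ : ∀ g → (toℕ (insert zero zero ρ ⟨$⟩ʳ g) <ᵇ suc (countTrue (λ i → T (suc i)))) ≡ T g
  sorted′ zero    = sym T0
  sorted′ (suc g) =
    trans (cong (λ h → toℕ h <ᵇ suc (countTrue (λ i → T (suc i)))) (insert-punchIn zero zero ρ g)) (sorted g)
... | ρ , sorted | false = insert zero c ρ , sorted′
  where
  t : ℕ
  t = countTrue (λ i → T (suc i))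
  c : Fin (suc k)
  c = fromℕ< (s≤s (countTrue≤ (λ i → T (suc i))))
  toℕ-c : toℕ c ≡ t
  toℕ-c = toℕ-fromℕ< _
  sorted′ : ∀ g → (toℕ (insert zero c ρ ⟨$⟩ʳ g) <ᵇ t) ≡ T g
  sorted′ zero    = trans (cong (_<ᵇ t) toℕ-c) (trans (≮⇒<ᵇ≡false (n≮n t)) (sym T0))
  sorted′ (suc g) = begin
    toℕ (insert zero c ρ ⟨$⟩ʳ suc g) <ᵇ t  ≡⟨ cong (λ h → toℕ h <ᵇ t) (insert-punchIn zero c ρ g) ⟩
    toℕ (punchIn c (ρ ⟨$⟩ʳ g)) <ᵇ t        ≡⟨ cong (toℕ (punchIn c (ρ ⟨$⟩ʳ g)) <ᵇ_) (sym toℕ-c) ⟩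
    toℕ (punchIn c (ρ ⟨$⟩ʳ g)) <ᵇ toℕ c    ≡⟨ punchIn-<ᵇ c (ρ ⟨$⟩ʳ g) ⟩
    toℕ (ρ ⟨$⟩ʳ g) <ᵇ toℕ c                ≡⟨ cong (toℕ (ρ ⟨$⟩ʳ g) <ᵇ_) toℕ-c ⟩
    toℕ (ρ ⟨$⟩ʳ g) <ᵇ t                    ≡⟨ sorted g ⟩
    T (suc g)                              ∎
    where open ≡-Reasoning

-- Vertices of the cube Q_N are indicator functions of sets of coordinates; coordinates from N on are ignored.
module Cube (N : ℕ) where

  -- Apart vertices are neither equal nor complementary, so they stay distinct in the folded cube.
  Apart : (ℕ → Bool) → (ℕ → Bool) → Set
  Apart P Q = ∃ λ a → ∃ λ b → a < N × b < N × P a ≢ Q a × P b ≡ Q b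

  Adjacent : (ℕ → Bool) → (ℕ → Bool) → Set
  Adjacent P Q = ∃ λ s → s < N × ∀ j → j < N → (j ≡ s → P j ≢ Q j) × (j ≢ s → P j ≡ Q j)

  Apart-intro : ∀ {P Q a b} → a < N → b < N → P a ≢ Q a → P b ≡ false → Q b ≡ false → Apart P Q
  Apart-intro a<N b<N Pa≢Qa Pb Qb = _ , _ , a<N , b<N , Pa≢Qa , trans Pb (sym Qb)

  Apart-sym : ∀ {P Q} → Apart P Q → Apart Q P
  Apart-sym (a , b , a<N , b<N , Pa≢Qa , Pb≡Qb) = a , b , a<N , b<N , (λ e → Pa≢Qa (sym e)) , sym Pb≡Qb

-- x is lifted to the empty set of Q_{n+1}; T lifts y.
IsLift : ∀ {n} → Vertex n → Vertex n → (Fin (suc n) → Bool) → Set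
IsLift x y T = ∀ i → T (suc i) xor T zero ≡ lookup x i xor lookup y i

-- Cube coordinate coord (suc i) is the e_i direction and coord zero the u direction.
module Projection {n : ℕ} (x : Vertex n) (ρ : Permutation (suc n) (suc n)) where
  open Cube (suc n)

  coord : Fin (suc n) → ℕ
  coord g = toℕ (ρ ⟨$⟩ʳ g)

  coord< : ∀ g → coord g < suc n
  coord< g = toℕ<n (ρ ⟨$⟩ʳ g)

  coord-injective : ∀ g h → coord g ≡ coord h → g ≡ h
  coord-injective g h e = trans (sym (inverseˡ ρ)) (trans (cong (ρ ⟨$⟩ˡ_) (toℕ-injective e)) (inverseˡ ρ))

  coord⁻¹ : ∀ a → a < suc n → Fin (suc n)
  coord⁻¹ a a< = ρ ⟨$⟩ˡ fromℕ< a<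

  coord-coord⁻¹ : ∀ a (a< : a < suc n) → coord (coord⁻¹ a a<) ≡ a
  coord-coord⁻¹ a a< = trans (cong toℕ (inverseʳ ρ)) (toℕ-fromℕ< a<)

  project : (ℕ → Bool) → Vertex n
  project P = tabulate (λ i → lookup x i xor (P (coord (suc i)) xor P (coord zero)))

  lookup-project : ∀ P i → lookup (project P) i ≡ lookup x i xor (P (coord (suc i)) xor P (coord zero))
  lookup-project P i = lookup∘tabulate _ i

  Δ : (ℕ → Bool) → (ℕ → Bool) → Fin (suc n) → Bool
  Δ P Q g = P (coord g) xor Q (coord g)

  lookup-project-xor : ∀ P Q i → lookup (zipWith _xor_ (project P) (project Q)) i ≡ Δ P Q (suc i) xor Δ P Q zero
  lookup-project-xor P Q i = begin
    lookup (zipWith _xor_ (project P) (project Q)) i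
      ≡⟨ lookup-zipWith _xor_ i (project P) (project Q) ⟩
    lookup (project P) i xor lookup (project Q) i
      ≡⟨ cong₂ _xor_ (lookup-project P i) (lookup-project Q i) ⟩
    (lookup x i xor (P (coord (suc i)) xor P (coord zero))) xor (lookup x i xor (Q (coord (suc i)) xor Q (coord zero)))
      ≡⟨ xor-cancelˡ (lookup x i) _ _ ⟩
    (P (coord (suc i)) xor P (coord zero)) xor (Q (coord (suc i)) xor Q (coord zero))
      ≡⟨ interchange (P (coord (suc i))) _ _ _ ⟩
    (P (coord (suc i)) xor Q (coord (suc i))) xor (P (coord zero) xor Q (coord zero)) ∎
    where open ≡-Reasoning

  Apart⇒project-≢ : ∀ {P Q} → Apart P Q → project P ≢ project Q
  Apart⇒project-≢ {P} {Q} (a , b , a< , b< , Pa≢Qa , Pb≡Qb) PP≡PQ =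
    differ (δ-at b b< (trans (cong (_xor Q b) Pb≡Qb) (xor-same (Q b))))
           (δ-at a a< (≢⇒xor≡true Pa≢Qa))
           (trans (δ-const (coord⁻¹ b b<)) (sym (δ-const (coord⁻¹ a a<))))
    where
    δ : Fin (suc n) → Bool
    δ = Δ P Q
    δ-const : ∀ g → δ g ≡ δ zero
    δ-const zero    = refl
    δ-const (suc i) = xor≡false⇒≡ (begin
      δ (suc i) xor δ zero                                 ≡⟨ lookup-project-xor P Q i ⟨
      lookup (zipWith _xor_ (project P) (project Q)) i     ≡⟨ cong (λ v → lookup (zipWith _xor_ v _) i) PP≡PQ ⟩
      lookup (zipWith _xor_ (project Q) (project Q)) i     ≡⟨ lookup-zipWith _xor_ i (project Q) (project Q) ⟩
      lookup (project Q) i xor lookup (project Q) i        ≡⟨ xor-same (lookup (project Q) i) ⟩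
      false                                                ∎)
      where open ≡-Reasoning
    δ-at : ∀ {v} a (a< : a < suc n) → P a xor Q a ≡ v → δ (coord⁻¹ a a<) ≡ v
    δ-at a a< e = trans (cong (λ j → P j xor Q j) (coord-coord⁻¹ a a<)) e

  Adjacent⇒FQAdj : ∀ {P Q} → Adjacent P Q → FQAdj (project P) (project Q)
  Adjacent⇒FQAdj {P} {Q} (s , s< , flip) = edgeAlong (coord⁻¹ s s<) (coord-coord⁻¹ s s<)
    where
    δ : Fin (suc n) → Bool
    δ = Δ P Q
    flipped : ∀ g → coord g ≡ s → δ g ≡ true
    flipped g e = ≢⇒xor≡true (proj₁ (flip (coord g) (coord< g)) e)
    unflipped : ∀ g → coord g ≢ s → δ g ≡ false
    unflipped g ne = trans (cong (_xor Q (coord g)) (proj₂ (flip (coord g) (coord< g)) ne)) (xor-same (Q (coord g)))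
    δ-xor : ∀ i → lookup (zipWith _xor_ (project P) (project Q)) i ≡ δ (suc i) xor δ zero
    δ-xor = lookup-project-xor P Q
    unflipped-other : ∀ {g h} → coord g ≡ s → g ≢ h → δ h ≡ false
    unflipped-other c≡s g≢h = unflipped _ (λ e → g≢h (coord-injective _ _ (trans c≡s (sym e))))
    edgeAlong : ∀ g → coord g ≡ s → FQAdj (project P) (project Q)
    edgeAlong zero c≡s = inj₂ (Pointwise-≡⇒≡ (ext λ i → begin
      lookup (zipWith _xor_ (project P) (project Q)) i  ≡⟨ δ-xor i ⟩
      δ (suc i) xor δ zero                              ≡⟨ cong₂ _xor_ (unflipped-other c≡s 0≢suc) (flipped zero c≡s) ⟩
      true                                              ≡⟨ lookup-replicate i true ⟨
      lookup (allOnes n) i                              ∎))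
      where open ≡-Reasoning
    edgeAlong (suc i₀) c≡s = inj₁ (i₀ , Pointwise-≡⇒≡ (ext λ i → begin
      lookup (zipWith _xor_ (project P) (project Q)) i  ≡⟨ δ-xor i ⟩
      δ (suc i) xor δ zero                              ≡⟨ cong (δ (suc i) xor_) (unflipped-other c≡s (λ e → 0≢suc (sym e))) ⟩
      δ (suc i) xor false                               ≡⟨ xor-identityʳ (δ (suc i)) ⟩
      δ (suc i)                                         ≡⟨ δ-unit i ⟩
      does (i₀ Fin.≟ i)                                 ≡⟨ lookup∘tabulate _ i ⟨
      lookup (unitVec i₀) i                             ∎))
      where open ≡-Reasoning
            δ-unit : ∀ i → δ (suc i) ≡ does (i₀ Fin.≟ i)
            δ-unit i with i₀ Fin.≟ i
            ... | yes refl = flipped (suc i) c≡s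
            ... | no i₀≢i  = unflipped-other c≡s (λ e → i₀≢i (suc-injective e))

  project-empty : ∀ P → (∀ j → P j ≡ false) → project P ≡ x
  project-empty P empty = Pointwise-≡⇒≡ (ext λ i →
    trans (lookup-project P i) (trans (cong₂ (λ a b → lookup x i xor (a xor b)) (empty _) (empty _)) (xor-identityʳ _)))

  project-lift : ∀ {y} P → IsLift x y (P ∘ coord) → project P ≡ y
  project-lift {y} P lift = Pointwise-≡⇒≡ (ext λ i → begin
    lookup (project P) i                              ≡⟨ lookup-project P i ⟩
    lookup x i xor (P (coord (suc i)) xor P (coord zero)) ≡⟨ cong (lookup x i xor_) (lift i) ⟩
    lookup x i xor (lookup x i xor lookup y i)        ≡⟨ xor-assoc (lookup x i) _ _ ⟨
    (lookup x i xor lookup x i) xor lookup y i        ≡⟨ cong (_xor lookup y i) (xor-same (lookup x i)) ⟩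
    lookup y i                                        ∎)
    where open ≡-Reasoning

applyUpTo-walk : ∀ {A : Set} {x y} (w : ℕ → A) ℓ → w 0 ≡ x → w (suc ℓ) ≡ y →
  applyUpTo w (2 + ℓ) ≡ x ∷ applyUpTo (w ∘ suc) ℓ ++ y ∷ []
applyUpTo-walk w ℓ refl refl = cong (w 0 ∷_) (sym (applyUpTo-∷ʳ (w ∘ suc) ℓ))

walkPath : ∀ {n x y} (w : ℕ → Vertex n) ℓ → w 0 ≡ x → w (suc ℓ) ≡ y →
  (∀ {k} → k < suc ℓ → FQAdj (w k) (w (suc k))) →
  (∀ {k k′} → k < k′ → k′ ≤ suc ℓ → w k ≢ w k′) → FQPath n x y
walkPath w ℓ w₀ wₗ adjacent distinct = record
  { internal = applyUpTo (w ∘ suc) ℓ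
  ; distinct = subst Unique (applyUpTo-walk w ℓ w₀ wₗ)
      (Uniqueₚ.applyUpTo⁺₁ w (2 + ℓ) (λ k<k′ k′<2+ℓ → distinct k<k′ (s≤s⁻¹ k′<2+ℓ)))
  ; adjacent = subst (Linked FQAdj) (applyUpTo-walk w ℓ w₀ wₗ)
      (Linkedₚ.applyUpTo⁺₁ w (2 + ℓ) (λ 1+k<2+ℓ → adjacent (s≤s⁻¹ 1+k<2+ℓ)))
  }

module Cyclic (t₀ : ℕ) where

  t : ℕ
  t = suc t₀

  [m%t+n]%t≡[m+n]%t : ∀ m n → ((m % t) + n) % t ≡ (m + n) % t
  [m%t+n]%t≡[m+n]%t m n = begin
    ((m % t) + n) % t            ≡⟨ %-distribˡ-+ (m % t) n t ⟩
    ((m % t % t) + (n % t)) % t  ≡⟨ cong (λ z → (z + (n % t)) % t) (m%n%n≡m%n m t) ⟩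
    ((m % t) + (n % t)) % t      ≡⟨ %-distribˡ-+ m n t ⟨
    (m + n) % t                  ∎
    where open ≡-Reasoning

  [m+n%t]%t≡[m+n]%t : ∀ m n → (m + (n % t)) % t ≡ (m + n) % t
  [m+n%t]%t≡[m+n]%t m n = begin
    (m + (n % t)) % t  ≡⟨ cong (_% t) (+-comm m (n % t)) ⟩
    ((n % t) + m) % t  ≡⟨ [m%t+n]%t≡[m+n]%t n m ⟩
    (n + m) % t        ≡⟨ cong (_% t) (+-comm n m) ⟩
    (m + n) % t        ∎
    where open ≡-Reasoning

  offset : ℕ → ℕ → ℕ
  offset p j = (j + (t ∸ p)) % t

  shift : ℕ → ℕ → ℕ
  shift p k = (p + k) % t

  offset<t : ∀ p j → offset p j < t
  offset<t p j = m%n<n (j + (t ∸ p)) t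

  shift<t : ∀ p k → shift p k < t
  shift<t p k = m%n<n (p + k) t

  shift-offset : ∀ {p j} → p < t → j < t → shift p (offset p j) ≡ j
  shift-offset {p} {j} p<t j<t = begin
    (p + ((j + (t ∸ p)) % t)) % t  ≡⟨ [m+n%t]%t≡[m+n]%t p _ ⟩
    (p + (j + (t ∸ p))) % t        ≡⟨ cong (_% t) (+-comm p _) ⟩
    (j + (t ∸ p) + p) % t          ≡⟨ cong (_% t) (+-assoc j _ p) ⟩
    (j + ((t ∸ p) + p)) % t        ≡⟨ cong (λ z → (j + z) % t) (m∸n+n≡m (<⇒≤ p<t)) ⟩
    (j + t) % t                    ≡⟨ [m+n]%n≡m%n j t ⟩
    j % t                          ≡⟨ m<n⇒m%n≡m j<t ⟩
    j                              ∎
    where open ≡-Reasoning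

  offset-shift : ∀ a b i → offset a (shift b i) ≡ (offset a b + i) % t
  offset-shift a b i = begin
    (((b + i) % t) + (t ∸ a)) % t  ≡⟨ [m%t+n]%t≡[m+n]%t (b + i) _ ⟩
    (b + i + (t ∸ a)) % t          ≡⟨ cong (_% t) (+-CommSemigroup.xy∙z≈xz∙y b i (t ∸ a)) ⟩
    (b + (t ∸ a) + i) % t          ≡⟨ [m%t+n]%t≡[m+n]%t (b + (t ∸ a)) i ⟨
    (((b + (t ∸ a)) % t) + i) % t  ∎
    where open ≡-Reasoning

  offset-self : ∀ {p} → p < t → offset p p ≡ 0
  offset-self {p} p<t = trans (cong (_% t) (m+[n∸m]≡n (<⇒≤ p<t))) (n%n≡0 t)

  offset-shift-self : ∀ {p k} → p < t → k < t → offset p (shift p k) ≡ k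
  offset-shift-self {p} {k} p<t k<t =
    trans (offset-shift p p k) (trans (cong (λ z → (z + k) % t) (offset-self p<t)) (m<n⇒m%n≡m k<t))

  -- shift b t₀ is the cyclic predecessor of b.
  offset-predecessor< : ∀ {a b} → a < t → b < t → a ≢ b → offset a (shift b t₀) < offset a b
  offset-predecessor< {a} {b} a<t b<t a≢b with offset a b in eq
  ... | zero = ⊥-elim (a≢b (begin
    a                 ≡⟨ m<n⇒m%n≡m a<t ⟨
    a % t             ≡⟨ cong (_% t) (+-identityʳ a) ⟨
    (a + 0) % t       ≡⟨ cong (λ z → shift a z) eq ⟨
    shift a (offset a b) ≡⟨ shift-offset a<t b<t ⟩
    b                 ∎))
    where open ≡-Reasoning
  ... | suc δ = ≤-reflexive (cong suc (begin
    offset a (shift b t₀)  ≡⟨ offset-shift a b t₀ ⟩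
    (offset a b + t₀) % t  ≡⟨ cong (λ z → (z + t₀) % t) eq ⟩
    (suc δ + t₀) % t       ≡⟨ cong (_% t) (+-suc δ t₀) ⟨
    (δ + t) % t            ≡⟨ [m+n]%n≡m%n δ t ⟩
    δ % t                  ≡⟨ m<n⇒m%n≡m (<-trans (n<1+n δ) (subst (_< t) eq (offset<t a b))) ⟩
    δ                      ∎))
    where open ≡-Reasoning

-- Paths in Q_N from the empty set to [0, t), where t = suc t₀.
module CubePaths (t₀ N : ℕ) (t+2<N : 3 + t₀ < N) where
  open Cyclic t₀
  open Cube N

  t<N : t < N
  t<N = <-trans (n<1+n t) (<-trans (n<1+n (suc t)) t+2<N)

  1+t<N : suc t < N
  1+t<N = <-trans (n<1+n (suc t)) t+2<N

  rotation : ℕ → ℕ → ℕ → Bool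
  rotation p k j = (j <ᵇ t) ∧ (offset p j <ᵇ k)

  rotation-start : ∀ p j → rotation p 0 j ≡ false
  rotation-start p j = ∧-zeroʳ (j <ᵇ t)

  rotation-end : ∀ p j → rotation p t j ≡ (j <ᵇ t)
  rotation-end p j = trans (cong ((j <ᵇ t) ∧_) (<⇒<ᵇ≡true (offset<t p j))) (∧-identityʳ (j <ᵇ t))

  rotation-outside : ∀ p k {j} → t ≤ j → rotation p k j ≡ false
  rotation-outside p k {j} t≤j = cong (_∧ (offset p j <ᵇ k)) (≮⇒<ᵇ≡false (≤⇒≯ t≤j))

  rotation-shift : ∀ {p i} k → p < t → i < t → rotation p k (shift p i) ≡ (i <ᵇ k)
  rotation-shift {p} {i} k p<t i<t =
    cong₂ _∧_ (<⇒<ᵇ≡true (shift<t p i)) (cong (_<ᵇ k) (offset-shift-self p<t i<t))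

  rotation-adjacent : ∀ {p k} → p < t → k < t → Adjacent (rotation p k) (rotation p (suc k))
  rotation-adjacent {p} {k} p<t k<t = shift p k , <-trans (shift<t p k) t<N , λ j _ → flipped j , unflipped j
    where
    flipped : ∀ j → j ≡ shift p k → rotation p k j ≢ rotation p (suc k) j
    flipped _ refl = differ (trans (rotation-shift k p<t k<t) (≮⇒<ᵇ≡false (n≮n k)))
                            (trans (rotation-shift (suc k) p<t k<t) (<⇒<ᵇ≡true (n<1+n k)))
    unflipped : ∀ j → j ≢ shift p k → rotation p k j ≡ rotation p (suc k) j
    unflipped j j≢ with j <? t
    ... | yes j<t =
      cong ((j <ᵇ t) ∧_) (sym (<ᵇ-suc-≢ (λ e → j≢ (trans (sym (shift-offset p<t j<t)) (cong (shift p) e)))))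
    ... | no j≮t  = trans (rotation-outside p k (≮⇒≥ j≮t)) (sym (rotation-outside p (suc k) (≮⇒≥ j≮t)))

  rotation-apart : ∀ {p k k′} → p < t → k < k′ → k′ ≤ t → Apart (rotation p k) (rotation p k′)
  rotation-apart {p} {k} {k′} p<t k<k′ k′≤t =
    Apart-intro (<-trans (shift<t p k) t<N) t<N
      (differ (trans (rotation-shift k p<t k<t) (≮⇒<ᵇ≡false (n≮n k)))
              (trans (rotation-shift k′ p<t k<t) (<⇒<ᵇ≡true k<k′)))
      (rotation-outside p k ≤-refl) (rotation-outside p k′ ≤-refl)
    where
    k<t : k < t
    k<t = <-≤-trans k<k′ k′≤t

  -- If p lies on the first k′ steps of the rotation from p′ ≠ p, so does its predecessor,
  -- which the first k < t steps of the rotation from p never reach.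
  rotation-apart-rotation : ∀ {p p′ k} k′ → p < t → p′ < t → p ≢ p′ → 0 < k → k < t →
    Apart (rotation p k) (rotation p′ k′)
  rotation-apart-rotation {p} {p′} {k} k′ p<t p′<t p≢p′ 0<k k<t
    with offset p′ p <? k′
  ... | yes p∈ = Apart-intro (<-trans (shift<t p t₀) t<N) t<N
      (differ (trans (rotation-shift k p<t (n<1+n t₀)) (≮⇒<ᵇ≡false (≤⇒≯ (s≤s⁻¹ k<t))))
              (cong₂ _∧_ (<⇒<ᵇ≡true (shift<t p t₀))
                         (<⇒<ᵇ≡true (<-trans (offset-predecessor< p′<t p<t (λ e → p≢p′ (sym e))) p∈))))
      (rotation-outside p k ≤-refl) (rotation-outside p′ k′ ≤-refl)
  ... | no p∉ = Apart-intro (<-trans p<t t<N) t<N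
      (λ e → differ (trans (cong ((p <ᵇ t) ∧_) (≮⇒<ᵇ≡false p∉)) (∧-zeroʳ (p <ᵇ t)))
                    (cong₂ _∧_ (<⇒<ᵇ≡true p<t) (trans (cong (_<ᵇ k) (offset-self p<t)) (<⇒<ᵇ≡true 0<k)))
                    (sym e))
      (rotation-outside p k ≤-refl) (rotation-outside p′ k′ ≤-refl)

  spareAbove : ∀ m → ∃ λ b → t ≤ b × b < N × b ≢ t × b ≢ m
  spareAbove m with suc t ≟ m
  ... | no 1+t≢m = suc t , n≤1+n t , 1+t<N , 1+n≢n , 1+t≢m
  ... | yes refl = 2 + t , m≤n⇒m≤1+n (n≤1+n t) , t+2<N , >⇒≢ (<-trans (n<1+n t) (n<1+n (suc t))) , 1+n≢n

  spare : ∀ m m′ → ∃ λ b → t ≤ b × b < N × b ≢ m × b ≢ m′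
  spare m m′ with t ≟ m | t ≟ m′
  ... | no t≢m | no t≢m′ = t , ≤-refl , t<N , t≢m , t≢m′
  ... | yes refl | _     = spareAbove m′
  ... | no _ | yes refl  = let b , t≤b , b<N , b≢t , b≢m = spareAbove m in b , t≤b , b<N , b≢m , b≢t

  detour : ℕ → ℕ → ℕ → Bool
  detour m zero    j = false
  detour m (suc k) j = if k ≤ᵇ t then (j ≡ᵇ m) ∨ (j <ᵇ k) else (j <ᵇ t)

  detour-early : ∀ m {k} j → k ≤ t → detour m (suc k) j ≡ ((j ≡ᵇ m) ∨ (j <ᵇ k))
  detour-early m {k} j k≤t = cong (if_then (j ≡ᵇ m) ∨ (j <ᵇ k) else (j <ᵇ t)) (dec-true (k ≤? t) k≤t)

  detour-late : ∀ m {k} j → ¬ k ≤ t → detour m (suc k) j ≡ (j <ᵇ t)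
  detour-late m {k} j k≰t = cong (if_then (j ≡ᵇ m) ∨ (j <ᵇ k) else (j <ᵇ t)) (dec-false (k ≤? t) k≰t)

  detour-end : ∀ m j → detour m (2 + t) j ≡ (j <ᵇ t)
  detour-end m j = detour-late m j (1+n≰n {t})

  detour-at : ∀ m {k} → 0 < k → k ≤ suc t → detour m k m ≡ true
  detour-at m {suc k} _ k<1+t = trans (detour-early m m (s≤s⁻¹ k<1+t)) (cong (_∨ (m <ᵇ k)) (≡ᵇ-refl m))

  detour-outside : ∀ m k {b} → t ≤ b → b ≢ m → detour m k b ≡ false
  detour-outside m zero    t≤b b≢m = refl
  detour-outside m (suc k) {b} t≤b b≢m with k ≤? t
  ... | yes k≤t = trans (detour-early m b k≤t)
                        (cong₂ _∨_ (≢⇒≡ᵇ≡false b≢m) (≮⇒<ᵇ≡false (λ b<k → <⇒≱ (<-≤-trans b<k k≤t) t≤b)))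
  ... | no k≰t  = trans (detour-late m b k≰t) (≮⇒<ᵇ≡false (≤⇒≯ t≤b))

  detour-adjacent : ∀ {m} k → t ≤ m → m < N → k < 2 + t → Adjacent (detour m k) (detour m (suc k))
  detour-adjacent {m} zero t≤m m<N _ = m , m<N , λ j _ → flipped j , unflipped j
    where
    flipped : ∀ j → j ≡ m → detour m 0 j ≢ detour m 1 j
    flipped _ refl = differ refl (detour-at m (s≤s z≤n) (s≤s z≤n))
    unflipped : ∀ j → j ≢ m → detour m 0 j ≡ detour m 1 j
    unflipped j j≢m = sym (trans (detour-early m j z≤n) (cong (_∨ false) (≢⇒≡ᵇ≡false j≢m)))
  detour-adjacent {m} (suc k) t≤m m<N k<1+t with k <? t
  ... | yes k<t = k , <-trans k<t t<N , λ j _ → flipped j , unflipped j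
    where
    flipped : ∀ j → j ≡ k → detour m (suc k) j ≢ detour m (2 + k) j
    flipped _ refl = differ
      (trans (detour-early m k (<⇒≤ k<t)) (cong₂ _∨_ k≢m (≮⇒<ᵇ≡false (n≮n k))))
      (trans (detour-early m k k<t) (cong₂ _∨_ k≢m (<⇒<ᵇ≡true (n<1+n k))))
      where
      k≢m : (k ≡ᵇ m) ≡ false
      k≢m = ≢⇒≡ᵇ≡false (λ e → <⇒≱ k<t (subst (t ≤_) (sym e) t≤m))
    unflipped : ∀ j → j ≢ k → detour m (suc k) j ≡ detour m (2 + k) j
    unflipped j j≢k = begin
      detour m (suc k) j         ≡⟨ detour-early m j (<⇒≤ k<t) ⟩
      (j ≡ᵇ m) ∨ (j <ᵇ k)       ≡⟨ cong ((j ≡ᵇ m) ∨_) (<ᵇ-suc-≢ j≢k) ⟨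
      (j ≡ᵇ m) ∨ (j <ᵇ suc k)   ≡⟨ detour-early m j k<t ⟨
      detour m (2 + k) j         ∎
      where open ≡-Reasoning
  ... | no k≮t = m , m<N , λ j _ → flipped j , unflipped j
    where
    k≡t : k ≡ t
    k≡t = ≤∧≮⇒≡ (s≤s⁻¹ (s≤s⁻¹ k<1+t)) k≮t
    last : ∀ j → detour m (suc k) j ≡ (j ≡ᵇ m) ∨ (j <ᵇ t)
    last j = trans (detour-early m j (≤-reflexive k≡t)) (cong (λ c → (j ≡ᵇ m) ∨ (j <ᵇ c)) k≡t)
    after : ∀ j → detour m (2 + k) j ≡ (j <ᵇ t)
    after j = detour-late m j (λ 1+k≤t → 1+n≰n (subst (suc k ≤_) (sym k≡t) 1+k≤t))
    flipped : ∀ j → j ≡ m → detour m (suc k) j ≢ detour m (2 + k) j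
    flipped _ refl = differ (trans (last m) (cong (_∨ (m <ᵇ t)) (≡ᵇ-refl m)))
                            (trans (after m) (≮⇒<ᵇ≡false (≤⇒≯ t≤m)))
    unflipped : ∀ j → j ≢ m → detour m (suc k) j ≡ detour m (2 + k) j
    unflipped j j≢m = trans (last j) (trans (cong (_∨ (j <ᵇ t)) (≢⇒≡ᵇ≡false j≢m)) (sym (after j)))

  detour-separates : ∀ {m k k′} → t ≤ m → m < N → k < k′ → k′ ≤ 2 + t →
    ∃ λ a → a < N × detour m k a ≢ detour m k′ a
  detour-separates {m} {zero} {suc k′} t≤m m<N _ k′≤2+t with k′ ≤? t
  ... | yes k′≤t = m , m<N , differ refl (detour-at m (s≤s z≤n) (s≤s k′≤t))
  ... | no k′≰t  =
    0 , <-trans (s≤s z≤n) t<N , differ refl (trans (detour-late m 0 k′≰t) (<⇒<ᵇ≡true {0} {t} (s≤s z≤n)))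
  detour-separates {m} {suc k} {suc k′} t≤m m<N k<k′ k′≤2+t with k′ ≤? t
  ... | yes k′≤t = k , <-trans k<t t<N , differ
      (trans (detour-early m k (<⇒≤ k<t)) (cong₂ _∨_ k≢m (≮⇒<ᵇ≡false (n≮n k))))
      (trans (detour-early m k k′≤t) (cong₂ _∨_ k≢m (<⇒<ᵇ≡true (s≤s⁻¹ k<k′))))
    where
    k<t : k < t
    k<t = <-≤-trans (s≤s⁻¹ k<k′) k′≤t
    k≢m : (k ≡ᵇ m) ≡ false
    k≢m = ≢⇒≡ᵇ≡false (λ e → <⇒≱ k<t (subst (t ≤_) (sym e) t≤m))
  ... | no k′≰t  = m , m<N , differ
      (detour-at m (s≤s z≤n) (s≤s⁻¹ (<-≤-trans k<k′ k′≤2+t)))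
      (trans (detour-late m m k′≰t) (≮⇒<ᵇ≡false (≤⇒≯ t≤m)))

  detour-apart : ∀ {m k k′} → t ≤ m → m < N → k < k′ → k′ ≤ 2 + t → Apart (detour m k) (detour m k′)
  detour-apart {m} {k} {k′} t≤m m<N k<k′ k′≤2+t =
    let a , a<N , separated = detour-separates t≤m m<N k<k′ k′≤2+t
        b , t≤b , b<N , b≢m , _ = spare m m
    in Apart-intro a<N b<N separated (detour-outside m k t≤b b≢m) (detour-outside m k′ t≤b b≢m)

  detour-apart-detour : ∀ {m m′ k k′} → t ≤ m → m < N → t ≤ m′ → m ≢ m′ →
    0 < k → k ≤ suc t → Apart (detour m k) (detour m′ k′)
  detour-apart-detour {m} {m′} {k} {k′} t≤m m<N t≤m′ m≢m′ 0<k k≤1+t =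
    let b , t≤b , b<N , b≢m , b≢m′ = spare m m′
    in Apart-intro m<N b<N (differ (detour-at m 0<k k≤1+t) (detour-outside m′ k′ t≤m m≢m′))
                   (detour-outside m k t≤b b≢m) (detour-outside m′ k′ t≤b b≢m′)

  rotation-apart-detour : ∀ p {m k k′} → t ≤ m → m < N → 0 < k′ → k′ ≤ suc t →
    Apart (rotation p k) (detour m k′)
  rotation-apart-detour p {m} {k} {k′} t≤m m<N 0<k′ k′≤1+t =
    let b , t≤b , b<N , b≢m , _ = spare m m
    in Apart-intro m<N b<N (differ (rotation-outside p k t≤m) (detour-at m 0<k′ k′≤1+t))
                   (rotation-outside p k t≤b) (detour-outside m k′ t≤b b≢m)

module ContainerConstruction {n : ℕ} (x y : Vertex n) (ρ : Permutation (suc n) (suc n))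
  (t₀ : ℕ) (t+2<1+n : 3 + t₀ < suc n) (lift : IsLift x y (λ g → toℕ (ρ ⟨$⟩ʳ g) <ᵇ suc t₀))
  where

  open Cube (suc n)
  open Projection x ρ
  open CubePaths t₀ (suc n) t+2<1+n
  open Cyclic t₀ using (t)

  cubeWalk : ∀ q → Dec (q < t) → ℕ → ℕ → Bool
  cubeWalk q (yes _) = rotation q
  cubeWalk q (no _)  = detour q

  interiorSize : ∀ q → Dec (q < t) → ℕ
  interiorSize q (yes _) = t₀
  interiorSize q (no _)  = suc t

  cubeWalk-start : ∀ q q<?t j → cubeWalk q q<?t 0 j ≡ false
  cubeWalk-start q (yes _) j = rotation-start q j
  cubeWalk-start q (no _)  j = refl

  cubeWalk-end : ∀ q q<?t j → cubeWalk q q<?t (suc (interiorSize q q<?t)) j ≡ (j <ᵇ t)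
  cubeWalk-end q (yes _) = rotation-end q
  cubeWalk-end q (no _)  = detour-end q

  cubeWalk-adjacent : ∀ q q<?t → q < suc n → ∀ {k} → k < suc (interiorSize q q<?t) →
    Adjacent (cubeWalk q q<?t k) (cubeWalk q q<?t (suc k))
  cubeWalk-adjacent q (yes q<t) _   k<1+ℓ = rotation-adjacent q<t k<1+ℓ
  cubeWalk-adjacent q (no q≮t)  q<N {k} k<1+ℓ = detour-adjacent k (≮⇒≥ q≮t) q<N k<1+ℓ

  cubeWalk-apart : ∀ q q<?t → q < suc n → ∀ {k k′} → k < k′ → k′ ≤ suc (interiorSize q q<?t) →
    Apart (cubeWalk q q<?t k) (cubeWalk q q<?t k′)
  cubeWalk-apart q (yes q<t) _   {k} {k′} k<k′ k′≤1+ℓ = rotation-apart {k = k} {k′} q<t k<k′ k′≤1+ℓ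
  cubeWalk-apart q (no q≮t)  q<N {k} {k′} k<k′ k′≤1+ℓ =
    detour-apart {k = k} {k′} (≮⇒≥ q≮t) q<N k<k′ k′≤1+ℓ

  cubeWalk-apart-cubeWalk : ∀ q q′ q<?t q′<?t → q < suc n → q′ < suc n → q ≢ q′ → ∀ {k k′} →
    0 < k → k ≤ interiorSize q q<?t → 0 < k′ → k′ ≤ interiorSize q′ q′<?t →
    Apart (cubeWalk q q<?t k) (cubeWalk q′ q′<?t k′)
  cubeWalk-apart-cubeWalk q q′ (yes q<t) (yes q′<t) _ _ q≢q′ {k} {k′} 0<k k≤ℓ _ _ =
    rotation-apart-rotation {k = k} k′ q<t q′<t q≢q′ 0<k (s≤s k≤ℓ)
  cubeWalk-apart-cubeWalk q q′ (yes _) (no q′≮t) _ q′<N _ {k} {k′} _ _ 0<k′ k′≤ℓ′ =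
    rotation-apart-detour q {k = k} {k′} (≮⇒≥ q′≮t) q′<N 0<k′ k′≤ℓ′
  cubeWalk-apart-cubeWalk q q′ (no q≮t) (yes _) q<N _ _ {k} {k′} 0<k k≤ℓ _ _ =
    Apart-sym (rotation-apart-detour q′ {k = k′} {k} (≮⇒≥ q≮t) q<N 0<k k≤ℓ)
  cubeWalk-apart-cubeWalk q q′ (no q≮t) (no q′≮t) q<N _ q≢q′ {k} {k′} 0<k k≤ℓ _ _ =
    detour-apart-detour {k = k} {k′} (≮⇒≥ q≮t) q<N (≮⇒≥ q′≮t) q≢q′ 0<k k≤ℓ

  role : ∀ g → Dec (coord g < t)
  role g = coord g <? t

  walkOf : Fin (suc n) → ℕ → Vertex n
  walkOf g k = project (cubeWalk (coord g) (role g) k)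

  interior : Fin (suc n) → ℕ
  interior g = interiorSize (coord g) (role g)

  pathOf : Fin (suc n) → FQPath n x y
  pathOf g = walkPath (walkOf g) (interior g)
    (project-empty (W 0) (cubeWalk-start q q<?t))
    (project-lift (W (suc (interior g))) λ i →
      trans (cong₂ _xor_ (cubeWalk-end q q<?t (coord (suc i))) (cubeWalk-end q q<?t (coord zero))) (lift i))
    (λ k<1+ℓ → Adjacent⇒FQAdj (cubeWalk-adjacent q q<?t (coord< g) k<1+ℓ))
    (λ k<k′ k′≤1+ℓ → Apart⇒project-≢ (cubeWalk-apart q q<?t (coord< g) k<k′ k′≤1+ℓ))
    where
    q : ℕ
    q = coord g
    q<?t : Dec (q < t)
    q<?t = role g
    W : ℕ → ℕ → Bool
    W = cubeWalk q q<?t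

  pathOf-disjoint : ∀ g h → g ≢ h → ∀ v → v ∈ internal (pathOf g) → v ∉ internal (pathOf h)
  pathOf-disjoint g h g≢h v v∈g v∈h =
    let k , k<ℓ , v≡ = Anyₚ.applyUpTo⁻ (walkOf g ∘ suc) v∈g
        k′ , k′<ℓ′ , v≡′ = Anyₚ.applyUpTo⁻ (walkOf h ∘ suc) v∈h
    in Apart⇒project-≢
         (cubeWalk-apart-cubeWalk (coord g) (coord h) (role g) (role h) (coord< g) (coord< h)
            (λ e → g≢h (coord-injective g h e)) (s≤s z≤n) k<ℓ (s≤s z≤n) k′<ℓ′)
         (trans (sym v≡) v≡′)

  -- Only a rotation path with t = 1, i.e. the edge x y itself, has no interior vertices.
  interior-nonempty : ∀ q q<?t → 0 < interiorSize q q<?t ⊎ q ≡ 0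
  interior-nonempty q       (no _)              = inj₁ (s≤s z≤n)
  interior-nonempty zero    (yes _)             = inj₂ refl
  interior-nonempty (suc q) (yes (s≤s 1+q≤t₀)) = inj₁ (<-≤-trans (s≤s z≤n) 1+q≤t₀)

  first∈ : ∀ g → 0 < interior g → walkOf g 1 ∈ internal (pathOf g)
  first∈ g 0<ℓ = Anyₚ.applyUpTo⁺ (walkOf g ∘ suc) refl 0<ℓ

  pathOf-distinct : ∀ g h → g ≢ h → internal (pathOf g) ≢ internal (pathOf h)
  pathOf-distinct g h g≢h same with interior-nonempty (coord g) (role g) | interior-nonempty (coord h) (role h)
  ... | inj₁ 0<ℓ | _ = pathOf-disjoint g h g≢h _ (first∈ g 0<ℓ) (subst (walkOf g 1 ∈_) same (first∈ g 0<ℓ))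
  ... | inj₂ _ | inj₁ 0<ℓ′ =
    pathOf-disjoint h g (λ e → g≢h (sym e)) _ (first∈ h 0<ℓ′)
      (subst (walkOf h 1 ∈_) (sym same) (first∈ h 0<ℓ′))
  ... | inj₂ g↦0 | inj₂ h↦0 = g≢h (coord-injective g h (trans g↦0 (sym h↦0)))

  container : Container n x y (suc n)
  container = record { path = pathOf ; pathsDistinct = pathOf-distinct ; internallyDisjoint = pathOf-disjoint }

  pathLength-pathOf : ∀ g → pathLength (pathOf g) ≡ suc (interior g)
  pathLength-pathOf g = cong suc (length-applyUpTo (walkOf g ∘ suc) (interior g))

  interiorSize≤ : ∀ q q<?t → suc (interiorSize q q<?t) ≤ t + 2
  interiorSize≤ q (yes _) = m≤m+n t 2
  interiorSize≤ q (no _)  = ≤-reflexive (+-comm 2 t)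

  interiorSize-outside : ∀ {q} q<?t → ¬ q < t → suc (interiorSize q q<?t) ≡ t + 2
  interiorSize-outside (yes q<t) q≮t = ⊥-elim (q≮t q<t)
  interiorSize-outside (no _)    _   = +-comm 2 t

  container-length : LengthEq container (t + 2)
  container-length =
    (λ g → subst (_≤ t + 2) (sym (pathLength-pathOf g)) (interiorSize≤ (coord g) (role g))) ,
    (g , trans (pathLength-pathOf g) (interiorSize-outside (role g) g∉T))
    where
    g : Fin (suc n)
    g = coord⁻¹ t t<N
    g∉T : ¬ coord g < t
    g∉T = subst (λ q → ¬ q < t) (sym (coord-coord⁻¹ t t<N)) (n≮n t)

liftedContainer : ∀ {n t} (x y : Vertex n) T → IsLift x y T → countTrue T ≡ t → 0 < t → t + 2 ≤ n →
  Σ (Container n x y (suc n)) λ C → LengthEq C (t + 2)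
liftedContainer {n} {suc t₀} x y T lift |T|≡t _ t+2≤n = container , container-length
  where
  ρ : Permutation (suc n) (suc n)
  ρ = proj₁ (sortingPermutation T)
  sorted : ∀ g → (toℕ (ρ ⟨$⟩ʳ g) <ᵇ suc t₀) ≡ T g
  sorted g = trans (cong (toℕ (ρ ⟨$⟩ʳ g) <ᵇ_) (sym |T|≡t)) (proj₂ (sortingPermutation T) g)
  open ContainerConstruction x y ρ t₀ (subst (_< suc n) (+-comm (suc t₀) 2) (s≤s t+2≤n))
         (λ i → trans (cong₂ _xor_ (sorted (suc i)) (sorted zero)) (lift i))

differenceSet : ∀ {n} → Vertex n → Vertex n → Fin (suc n) → Bool
differenceSet x y zero    = false
differenceSet x y (suc i) = lookup x i xor lookup y i

differenceSet-isLift : ∀ {n} (x y : Vertex n) → IsLift x y (differenceSet x y)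
differenceSet-isLift x y i = xor-identityʳ _

complement-isLift : ∀ {n} (x y : Vertex n) T → IsLift x y T → IsLift x y (not ∘ T)
complement-isLift x y T lift i = trans (xor-annihilates-not (T (suc i)) (T zero)) (lift i)

countTrue-differenceSet : ∀ {n} (x y : Vertex n) → countTrue (differenceSet x y) ≡ hamming x y
countTrue-differenceSet []      []      = refl
countTrue-differenceSet (a ∷ x) (b ∷ y) with a xor b
... | true  = cong suc (countTrue-differenceSet x y)
... | false = countTrue-differenceSet x y

hamming≤n : ∀ {n} (x y : Vertex n) → hamming x y ≤ n
hamming≤n {n} x y = subst (_≤ n) (countTrue-differenceSet x y) (countTrue≤ (λ i → lookup x i xor lookup y i))

hamming≡0⇒≡ : ∀ {n} (x y : Vertex n) → hamming x y ≡ 0 → x ≡ y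
hamming≡0⇒≡ []      []      _ = refl
hamming≡0⇒≡ (a ∷ x) (b ∷ y) h with a xor b in a⊕b
... | false = cong₂ _∷_ (xor≡false⇒≡ a⊕b) (hamming≡0⇒≡ x y h)

⌈n/2⌉+2≤n : ∀ n → 4 ≤ n → ⌈ n /2⌉ + 2 ≤ n
⌈n/2⌉+2≤n (suc (suc (suc (suc m)))) (s≤s (s≤s (s≤s (s≤s _)))) =
  subst (_≤ 4 + m) (+-comm 2 (2 + ⌈ m /2⌉)) (s≤s (s≤s (s≤s (s≤s (⌈n/2⌉≤n m)))))

⌊n/2⌋+2≤n : ∀ n → 4 ≤ n → ⌊ n /2⌋ + 2 ≤ n
⌊n/2⌋+2≤n n 4≤n = ≤-trans (+-monoˡ-≤ 2 (⌊n/2⌋≤⌈n/2⌉ n)) (⌈n/2⌉+2≤n n 4≤n)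

1+n∸m≤⌊n/2⌋ : ∀ n {m} → ⌈ n /2⌉ < m → suc n ∸ m ≤ ⌊ n /2⌋
1+n∸m≤⌊n/2⌋ n ⌈n/2⌉<m = ≤-trans (∸-monoʳ-≤ (suc n) ⌈n/2⌉<m) (≤-reflexive n∸⌈n/2⌉≡⌊n/2⌋)
  where
  n∸⌈n/2⌉≡⌊n/2⌋ : n ∸ ⌈ n /2⌉ ≡ ⌊ n /2⌋
  n∸⌈n/2⌉≡⌊n/2⌋ = trans (cong (_∸ ⌈ n /2⌉) (sym (⌊n/2⌋+⌈n/2⌉≡n n))) (m+n∸n≡m ⌊ n /2⌋ ⌈ n /2⌉)

mainTheorem16 : (n : ℕ) → 4 ≤ n → (x y : Vertex n) → x ≢ y →
    ((hamming x y ≤ ⌈ n /2⌉) →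
      Σ (Container n x y (suc n)) λ C → LengthEq C (hamming x y + 2))
    × ((hamming x y > ⌈ n /2⌉) →
      Σ (Container n x y (suc n)) λ C → LengthAtMost C (⌊ n /2⌋ + 2))
mainTheorem16 n 4≤n x y x≢y = short , long
  where
  D : Fin (suc n) → Bool
  D = differenceSet x y

  short : hamming x y ≤ ⌈ n /2⌉ → Σ (Container n x y (suc n)) λ C → LengthEq C (hamming x y + 2)
  short r≤⌈n/2⌉ = liftedContainer x y D (differenceSet-isLift x y) (countTrue-differenceSet x y)
    (n≢0⇒n>0 (λ r≡0 → x≢y (hamming≡0⇒≡ x y r≡0)))
    (≤-trans (+-monoˡ-≤ 2 r≤⌈n/2⌉) (⌈n/2⌉+2≤n n 4≤n))

  long : hamming x y > ⌈ n /2⌉ → Σ (Container n x y (suc n)) λ C → LengthAtMost C (⌊ n /2⌋ + 2)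
  long r>⌈n/2⌉ =
    let C , C≤ , _ = liftedContainer x y (not ∘ D) (complement-isLift x y D (differenceSet-isLift x y))
                       |∁D|≡1+n∸r (m<n⇒0<n∸m (s≤s (hamming≤n x y)))
                       (≤-trans (+-monoˡ-≤ 2 |∁D|≤⌊n/2⌋) (⌊n/2⌋+2≤n n 4≤n))
    in C , λ g → ≤-trans (C≤ g) (+-monoˡ-≤ 2 |∁D|≤⌊n/2⌋)
    where
    |∁D|≡1+n∸r : countTrue (not ∘ D) ≡ suc n ∸ hamming x y
    |∁D|≡1+n∸r = trans (countTrue-not D) (cong (suc n ∸_) (countTrue-differenceSet x y))
    |∁D|≤⌊n/2⌋ : suc n ∸ hamming x y ≤ ⌊ n /2⌋
    |∁D|≤⌊n/2⌋ = 1+n∸m≤⌊n/2⌋ n r>⌈n/2⌉
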